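{- Define $P=(p_{n,k})_{n,k\ge0}$ by $p_{n,k}=\frac{n!}{k!\,(n-k+1)!}(nS_{n-k+1}+1)$ for $0\le k\le n+1$ and $p_{n,k}=0$ for $k>n+1$, where $S_m=\sum_{j=0}^m m!/j!$. Then: (a) The $p_{n,k}$ are nonnegative integers satisfying the backward recurrence $p_{n,k}=(k+1)p_{n,k+1}+\binom{n}{k-1}$ (for $0\le k\le n$, with $\binom{n}{ -1}=0$) with initial condition $p_{n,n+1}=1$. (b) For $0\le k\le n+1$, $p_{n,k}=\dfrac{nS_n-Q_k(n)}{k!}$, where $Q_k(n)=-1+\sum_{j=2}^k(j-1)!\binom{n}{j-2}=-1+\sum_{j=2}^k(j-1)\,n^{\underline{j-2}}$ are polynomials in $n$ with integer coefficients ($n^{\underline{m}}=n(n-1)\cdots(n-m+1)$). In particular $Q_0(n)=Q_1(n)=-1$ and $Q_2(n)=0$, so that $p_{n,0}=p_{n,1}=nS_n+1$ and $p_{n,2}=nS_n/2$. -}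

module Defs where

open import Data.Nat using (ℕ; zero; suc; _∸_; _≤?_; _!) renaming (_+_ to _+ℕ_; _*_ to _*ℕ_)
open import Data.Nat.Properties using (_!≢0; _!*_!≢0)
open import Data.Nat.Combinatorics using (_C_; _P_)
open import Data.Integer using (ℤ; +_; -[1+_]) renaming (_+_ to _+ℤ_)
open import Data.Rational using (ℚ; _/_; _+_; _*_; 0ℚ)
open import Data.List using (List; []; _∷_; map; upTo; foldr)
open import Relation.Nullary using (yes; no)

ℤ→ℚ : ℤ → ℚ
ℤ→ℚ z = z / 1

ℕ→ℚ : ℕ → ℚ
ℕ→ℚ m = (+ m) / 1

range : ℕ → ℕ → List ℕ
range a b = map (a +ℕ_) (upTo (suc b ∸ a))

Σℚ[_⋯_] : ℕ → ℕ → (ℕ → ℚ) → ℚ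
Σℚ[ a ⋯ b ] f = foldr (λ j acc → f j + acc) 0ℚ (range a b)

Σℤ[_⋯_] : ℕ → ℕ → (ℕ → ℤ) → ℤ
Σℤ[ a ⋯ b ] f = foldr (λ j acc → f j +ℤ acc) (+ 0) (range a b)

S : ℕ → ℚ
S m = Σℚ[ 0 ⋯ m ] (λ j → _/_ (+ (m !)) (j !) {{j !≢0}})

p : ℕ → ℕ → ℚ
p n k with k ≤? suc n
... | yes _ = _/_ (+ (n !)) (k ! *ℕ (suc n ∸ k) !) {{k !* (suc n ∸ k) !≢0}}
              * (ℕ→ℚ n * S (suc n ∸ k) + ℕ→ℚ 1)
... | no _  = 0ℚ

-- binom(n, k-1), with binom(n, -1) = 0
binomPred : ℕ → ℕ → ℕ
binomPred n zero    = 0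
binomPred n (suc k) = n C k

Q : ℕ → ℕ → ℤ
Q k n = -[1+ 0 ] +ℤ Σℤ[ 2 ⋯ k ] (λ j → + ((j ∸ 1) ! *ℕ (n C (j ∸ 2))))

Q′ : ℕ → ℕ → ℤ
Q′ k n = -[1+ 0 ] +ℤ Σℤ[ 2 ⋯ k ] (λ j → + ((j ∸ 1) *ℕ (n P (j ∸ 2))))

inv! : ℕ → ℚ
inv! k = _/_ (+ 1) (k !) {{k !≢0}}

-- Writing m = n + 1 − k, the closed form is p n k = n! (n S_m + 1) / (k! m!), and S_{m+1} = (m+1) S_m + 1
-- shows that S_m is an integer. After cross-multiplication the backward recurrence becomes a
-- polynomial identity, once binom(n, k−1) · k! · (n−k+1)! is replaced by k · n!. Integrality follows
-- by descending induction from p n (n+1) = 1. For (b), the recurrence and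
-- Q_{k+1}(n) = Q_k(n) + k! binom(n, k−1) show that k! p n k + Q_k(n) does not depend on k;
-- at k = 0 it equals n S_n.
module Submission where

open import Defs
open import Algebra.Bundles using (Monoid; Semiring; CommutativeRing)
open import Data.Nat as ℕ using (ℕ; zero; suc; _≤_; _<_; _∸_; _!; z≤n; s≤s; NonZero)
import Data.Nat.Properties as ℕ
open import Data.List using (List; []; _∷_; [_]; map; foldr; upTo; _∷ʳ_)
open import Data.List.Properties using (applyUpTo-∷ʳ; map-++)
open import Function using (id)
open import Relation.Binary.PropositionalEquality using (_≡_; cong; module ≡-Reasoning)

range-suc : ∀ {a b} → a ≤ suc b → range a (suc b) ≡ range a b ∷ʳ suc b
range-suc {a} {b} a≤1+b = begin
  map (a ℕ.+_) (upTo (suc (suc b) ∸ a))  ≡⟨ cong (λ l → map (a ℕ.+_) (upTo l)) (ℕ.+-∸-assoc 1 a≤1+b) ⟩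
  map (a ℕ.+_) (upTo (suc k))            ≡⟨ cong (map (a ℕ.+_)) (applyUpTo-∷ʳ id k) ⟨
  map (a ℕ.+_) (upTo k ∷ʳ k)             ≡⟨ map-++ (a ℕ.+_) (upTo k) [ k ] ⟩
  map (a ℕ.+_) (upTo k) ∷ʳ (a ℕ.+ k)     ≡⟨ cong (map (a ℕ.+_) (upTo k) ∷ʳ_) (ℕ.m+[n∸m]≡n a≤1+b) ⟩
  map (a ℕ.+_) (upTo k) ∷ʳ suc b         ∎
  where
  open ≡-Reasoning
  k = suc b ∸ a

module RangeSum {c ℓ} (M : Monoid c ℓ) where
  open Monoid M
  open import Relation.Binary.Reasoning.Setoid setoid

  Σ[_⋯_] : ℕ → ℕ → (ℕ → Carrier) → Carrier
  Σ[ a ⋯ b ] f = foldr (λ j acc → f j ∙ acc) ε (range a b)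

  private
    Σ-list : (ℕ → Carrier) → List ℕ → Carrier
    Σ-list f = foldr (λ j acc → f j ∙ acc) ε

    Σ-list-∷ʳ : ∀ f xs x → Σ-list f (xs ∷ʳ x) ≈ Σ-list f xs ∙ f x
    Σ-list-∷ʳ f []       x = trans (identityʳ (f x)) (sym (identityˡ (f x)))
    Σ-list-∷ʳ f (y ∷ xs) x = begin
      f y ∙ Σ-list f (xs ∷ʳ x)     ≈⟨ ∙-congˡ (Σ-list-∷ʳ f xs x) ⟩
      f y ∙ (Σ-list f xs ∙ f x)    ≈⟨ assoc (f y) (Σ-list f xs) (f x) ⟨
      (f y ∙ Σ-list f xs) ∙ f x    ∎

    Σ-list-cong : ∀ {f g} a → (∀ i → f (a ℕ.+ i) ≈ g (a ℕ.+ i)) →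
                  ∀ xs → Σ-list f (map (a ℕ.+_) xs) ≈ Σ-list g (map (a ℕ.+_) xs)
    Σ-list-cong a f≈g []       = refl
    Σ-list-cong a f≈g (i ∷ xs) = ∙-cong (f≈g i) (Σ-list-cong a f≈g xs)

  Σ-suc : ∀ a b f → a ≤ suc b → Σ[ a ⋯ suc b ] f ≈ Σ[ a ⋯ b ] f ∙ f (suc b)
  Σ-suc a b f a≤1+b = begin
    Σ-list f (range a (suc b))     ≡⟨ cong (Σ-list f) (range-suc a≤1+b) ⟩
    Σ-list f (range a b ∷ʳ suc b)  ≈⟨ Σ-list-∷ʳ f (range a b) (suc b) ⟩
    Σ[ a ⋯ b ] f ∙ f (suc b)       ∎

  Σ-cong : ∀ a b f g → (∀ i → f (a ℕ.+ i) ≈ g (a ℕ.+ i)) → Σ[ a ⋯ b ] f ≈ Σ[ a ⋯ b ] g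
  Σ-cong a b f g f≈g = Σ-list-cong a f≈g (upTo (suc b ∸ a))

module RangeSum-* {c ℓ} (R : Semiring c ℓ) where
  open Semiring R
  open RangeSum +-monoid
  open import Relation.Binary.Reasoning.Setoid setoid

  Σ-*ˡ : ∀ c f a b → Σ[ a ⋯ b ] (λ j → c * f j) ≈ c * Σ[ a ⋯ b ] f
  Σ-*ˡ c f a b = go (range a b)
    where
    Σf : List ℕ → Carrier
    Σf = foldr (λ j acc → f j + acc) 0#
    go : ∀ xs → foldr (λ j acc → c * f j + acc) 0# xs ≈ c * Σf xs
    go []       = sym (zeroʳ c)
    go (x ∷ xs) = begin
      c * f x + foldr (λ j acc → c * f j + acc) 0# xs   ≈⟨ +-congˡ (go xs) ⟩
      c * f x + c * Σf xs                               ≈⟨ distribˡ c (f x) (Σf xs) ⟨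
      c * (f x + Σf xs)                                 ∎

open import Data.Nat.Properties using (_!≢0; _!*_!≢0; m*n≢0)
open import Data.Nat.Combinatorics
  using (_C_; _P_; nCk≡n!/k![n-k]!; k![n∸k]!∣n!; nPk≡n!/[n∸k]!; k>n⇒nPk≡0; k>n⇒nCk≡0)
open import Data.Nat.DivMod using (_/_; m/n*n≡m; m*n/n≡m; /-congˡ)
open import Data.Nat.Tactic.RingSolver using (solve-∀)
open import Data.Integer as ℤ using (ℤ; +_; -[1+_])
import Data.Integer.Properties as ℤ
open import Data.Rational as ℚ using (ℚ; _+_; _*_; _-_; 0ℚ; 1ℚ; ½; fromℚᵘ; toℚᵘ)
import Data.Rational.Properties as ℚ
open import Data.Rational.Solver using (module +-*-Solver)
open import Data.Rational.Unnormalised as ℚᵘ using (mkℚᵘ; *≡*)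
import Data.Rational.Unnormalised.Properties as ℚᵘ
open import Data.Product using (_×_; _,_; ∃-syntax)
open import Data.Sum using (inj₁; inj₂)
open import Relation.Nullary using (yes; no; contradiction)
open import Relation.Binary.PropositionalEquality using (refl; sym; trans; cong₂; subst)

fromℚᵘ-homo-* : ∀ p q → fromℚᵘ (p ℚᵘ.* q) ≡ fromℚᵘ p * fromℚᵘ q
fromℚᵘ-homo-* p q = ℚ.toℚᵘ-injective (begin
  toℚᵘ (fromℚᵘ (p ℚᵘ.* q))                ≈⟨ ℚ.toℚᵘ-fromℚᵘ (p ℚᵘ.* q) ⟩
  p ℚᵘ.* q                                ≈⟨ ℚᵘ.*-cong (ℚᵘ.≃-sym (ℚ.toℚᵘ-fromℚᵘ p)) (ℚᵘ.≃-sym (ℚ.toℚᵘ-fromℚᵘ q)) ⟩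
  toℚᵘ (fromℚᵘ p) ℚᵘ.* toℚᵘ (fromℚᵘ q)    ≈⟨ ℚ.toℚᵘ-homo-* (fromℚᵘ p) (fromℚᵘ q) ⟨
  toℚᵘ (fromℚᵘ p * fromℚᵘ q)              ∎)
  where open ℚᵘ.≃-Reasoning

fromℚᵘ-homo-+ : ∀ p q → fromℚᵘ (p ℚᵘ.+ q) ≡ fromℚᵘ p + fromℚᵘ q
fromℚᵘ-homo-+ p q = ℚ.toℚᵘ-injective (begin
  toℚᵘ (fromℚᵘ (p ℚᵘ.+ q))                ≈⟨ ℚ.toℚᵘ-fromℚᵘ (p ℚᵘ.+ q) ⟩
  p ℚᵘ.+ q                                ≈⟨ ℚᵘ.+-cong (ℚᵘ.≃-sym (ℚ.toℚᵘ-fromℚᵘ p)) (ℚᵘ.≃-sym (ℚ.toℚᵘ-fromℚᵘ q)) ⟩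
  toℚᵘ (fromℚᵘ p) ℚᵘ.+ toℚᵘ (fromℚᵘ q)    ≈⟨ ℚ.toℚᵘ-homo-+ (fromℚᵘ p) (fromℚᵘ q) ⟨
  toℚᵘ (fromℚᵘ p + fromℚᵘ q)              ∎)
  where open ℚᵘ.≃-Reasoning

infix 6.5 _÷_

_÷_ : ℕ → (d : ℕ) → .{{NonZero d}} → ℚ
a ÷ d = + a ℚ./ d

÷-cong : ∀ {a b m n} .{{_ : NonZero m}} .{{_ : NonZero n}} → a ≡ b → m ≡ n → a ÷ m ≡ b ÷ n
÷-cong refl refl = refl

module _ (a b : ℕ) where

  ÷-*-÷ : ∀ m n .{{_ : NonZero m}} .{{_ : NonZero n}} →
          (a ÷ m) * (b ÷ n) ≡ (a ℕ.* b ÷ m ℕ.* n) {{m*n≢0 m n}}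
  ÷-*-÷ (suc m) (suc n) = begin
    fromℚᵘ (mkℚᵘ (+ a) m) * fromℚᵘ (mkℚᵘ (+ b) n) ≡⟨ fromℚᵘ-homo-* (mkℚᵘ (+ a) m) (mkℚᵘ (+ b) n) ⟨
    (+ a ℤ.* + b) ℚ./ (suc m ℕ.* suc n)           ≡⟨ cong (ℚ._/ (suc m ℕ.* suc n)) (ℤ.pos-* a b) ⟨
    + (a ℕ.* b) ℚ./ (suc m ℕ.* suc n)             ∎
    where open ≡-Reasoning

  ÷-+-÷ : ∀ m n .{{_ : NonZero m}} .{{_ : NonZero n}} →
          (a ÷ m) + (b ÷ n) ≡ ((a ℕ.* n ℕ.+ b ℕ.* m) ÷ m ℕ.* n) {{m*n≢0 m n}}
  ÷-+-÷ (suc m) (suc n) = begin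
    fromℚᵘ (mkℚᵘ (+ a) m) + fromℚᵘ (mkℚᵘ (+ b) n)             ≡⟨ fromℚᵘ-homo-+ (mkℚᵘ (+ a) m) (mkℚᵘ (+ b) n) ⟨
    (+ a ℤ.* + suc n ℤ.+ + b ℤ.* + suc m) ℚ./ (suc m ℕ.* suc n) ≡⟨ cong (ℚ._/ (suc m ℕ.* suc n)) pos-numerator ⟨
    + (a ℕ.* suc n ℕ.+ b ℕ.* suc m) ℚ./ (suc m ℕ.* suc n)       ∎
    where
    open ≡-Reasoning
    pos-numerator : + (a ℕ.* suc n ℕ.+ b ℕ.* suc m) ≡ + a ℤ.* + suc n ℤ.+ + b ℤ.* + suc m
    pos-numerator = trans (ℤ.pos-+ (a ℕ.* suc n) (b ℕ.* suc m))
                          (cong₂ ℤ._+_ (ℤ.pos-* a (suc n)) (ℤ.pos-* b (suc m)))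

  ÷-cross : ∀ m n .{{_ : NonZero m}} .{{_ : NonZero n}} → a ℕ.* n ≡ b ℕ.* m → a ÷ m ≡ b ÷ n
  ÷-cross (suc m) (suc n) eq = ℚ.fromℚᵘ-cong {mkℚᵘ (+ a) m} {mkℚᵘ (+ b) n} (*≡* (begin
    + a ℤ.* + suc n   ≡⟨ ℤ.pos-* a (suc n) ⟨
    + (a ℕ.* suc n)   ≡⟨ cong +_ eq ⟩
    + (b ℕ.* suc m)   ≡⟨ ℤ.pos-* b (suc m) ⟩
    + b ℤ.* + suc m   ∎))
    where open ≡-Reasoning

ℕ→ℚ-homo-* : ∀ a b → ℕ→ℚ (a ℕ.* b) ≡ ℕ→ℚ a * ℕ→ℚ b
ℕ→ℚ-homo-* a b = sym (÷-*-÷ a b 1 1)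

ℤ→ℚ-homo-+ : ∀ i j → ℤ→ℚ (i ℤ.+ j) ≡ ℤ→ℚ i + ℤ→ℚ j
ℤ→ℚ-homo-+ i j = trans (cong (ℚ._/ 1) (sym (cong₂ ℤ._+_ (ℤ.*-identityʳ i) (ℤ.*-identityʳ j))))
                       (fromℚᵘ-homo-+ (mkℚᵘ i 0) (mkℚᵘ j 0))

ℕ→ℚ-homo-+ : ∀ a b → ℕ→ℚ (a ℕ.+ b) ≡ ℕ→ℚ a + ℕ→ℚ b
ℕ→ℚ-homo-+ a b = trans (cong ℤ→ℚ (ℤ.pos-+ a b)) (ℤ→ℚ-homo-+ (+ a) (+ b))

ℕ→ℚ-*-÷ : ∀ c a d .{{_ : NonZero d}} → ℕ→ℚ c * (a ÷ d) ≡ c ℕ.* a ÷ d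
ℕ→ℚ-*-÷ c a d = trans (÷-*-÷ c a 1 d) (÷-cong {c ℕ.* a} {{m*n≢0 1 d}} refl (ℕ.*-identityˡ d))

÷-+-ℕ→ℚ : ∀ a b d .{{_ : NonZero d}} → a ÷ d + ℕ→ℚ b ≡ (a ℕ.+ b ℕ.* d) ÷ d
÷-+-ℕ→ℚ a b d = trans (÷-+-÷ a b d 1)
  (÷-cong {{m*n≢0 d 1}} (cong (ℕ._+ b ℕ.* d) (ℕ.*-identityʳ a)) (ℕ.*-identityʳ d))

open RangeSum ℚ.+-0-monoid using () renaming (Σ-suc to Σℚ-suc; Σ-cong to Σℚ-cong)
open RangeSum ℤ.+-0-monoid using () renaming (Σ-suc to Σℤ-suc; Σ-cong to Σℤ-cong)
open RangeSum-* (CommutativeRing.semiring ℚ.+-*-commutativeRing) using () renaming (Σ-*ˡ to Σℚ-*ˡ)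
open +-*-Solver

ℕ→ℚ-homo-*-+1 : ∀ a b → ℕ→ℚ a * ℕ→ℚ b + 1ℚ ≡ ℕ→ℚ (a ℕ.* b ℕ.+ 1)
ℕ→ℚ-homo-*-+1 a b = begin
  ℕ→ℚ a * ℕ→ℚ b + ℕ→ℚ 1    ≡⟨ cong (_+ ℕ→ℚ 1) (ℕ→ℚ-homo-* a b) ⟨
  ℕ→ℚ (a ℕ.* b) + ℕ→ℚ 1    ≡⟨ ℕ→ℚ-homo-+ (a ℕ.* b) 1 ⟨
  ℕ→ℚ (a ℕ.* b ℕ.+ 1)      ∎
  where open ≡-Reasoning

Sℕ : ℕ → ℕ
Sℕ zero    = 1
Sℕ (suc m) = suc m ℕ.* Sℕ m ℕ.+ 1

S-suc : ∀ m → S (suc m) ≡ ℕ→ℚ (suc m) * S m + 1ℚ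
S-suc m = begin
  S (suc m)                                                      ≡⟨ Σℚ-suc 0 m (λ j → (suc m !) ÷[ j ]!) z≤n ⟩
  Σℚ[ 0 ⋯ m ] (λ j → (suc m !) ÷[ j ]!) + (suc m !) ÷[ suc m ]!  ≡⟨ cong₂ _+_ (Σℚ-cong 0 m _ _ pull-factor) last-term ⟩
  Σℚ[ 0 ⋯ m ] (λ j → ℕ→ℚ (suc m) * (m !) ÷[ j ]!) + 1ℚ           ≡⟨ cong (_+ 1ℚ) (Σℚ-*ˡ (ℕ→ℚ (suc m)) (λ j → (m !) ÷[ j ]!) 0 m) ⟩
  ℕ→ℚ (suc m) * S m + 1ℚ                                         ∎
  where
  open ≡-Reasoning
  _÷[_]! : ℕ → ℕ → ℚ
  a ÷[ j ]! = (a ÷ (j !)) {{j !≢0}}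
  pull-factor : ∀ j → (suc m !) ÷[ j ]! ≡ ℕ→ℚ (suc m) * (m !) ÷[ j ]!
  pull-factor j = sym (ℕ→ℚ-*-÷ (suc m) (m !) (j !) {{j !≢0}})
  last-term : (suc m !) ÷[ suc m ]! ≡ 1ℚ
  last-term = ÷-cross (suc m !) 1 (suc m !) 1 {{suc m !≢0}} (ℕ.*-comm (suc m !) 1)

S≡Sℕ : ∀ m → S m ≡ ℕ→ℚ (Sℕ m)
S≡Sℕ zero    = refl
S≡Sℕ (suc m) = begin
  S (suc m)                            ≡⟨ S-suc m ⟩
  ℕ→ℚ (suc m) * S m + 1ℚ               ≡⟨ cong (λ x → ℕ→ℚ (suc m) * x + 1ℚ) (S≡Sℕ m) ⟩
  ℕ→ℚ (suc m) * ℕ→ℚ (Sℕ m) + 1ℚ        ≡⟨ ℕ→ℚ-homo-*-+1 (suc m) (Sℕ m) ⟩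
  ℕ→ℚ (Sℕ (suc m))                     ∎
  where open ≡-Reasoning

nS+1≡ℕ→ℚ : ∀ n m → ℕ→ℚ n * S m + 1ℚ ≡ ℕ→ℚ (n ℕ.* Sℕ m ℕ.+ 1)
nS+1≡ℕ→ℚ n m = trans (cong (λ x → ℕ→ℚ n * x + 1ℚ) (S≡Sℕ m)) (ℕ→ℚ-homo-*-+1 n (Sℕ m))

p-closed : ∀ n k m → k ℕ.+ m ≡ suc n →
           p n k ≡ (n ! ℕ.* (n ℕ.* Sℕ m ℕ.+ 1) ÷ k ! ℕ.* m !) {{k !* m !≢0}}
p-closed n k m k+m≡1+n with k ℕ.≤? suc n
... | no k≰1+n = contradiction (subst (k ≤_) k+m≡1+n (ℕ.m≤m+n k m)) k≰1+n
... | yes _ rewrite sym k+m≡1+n | ℕ.m+n∸m≡n k m = begin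
  (n ! ÷ k ! ℕ.* m !) * (ℕ→ℚ n * S m + 1ℚ)      ≡⟨ cong ((n ! ÷ k ! ℕ.* m !) *_) (nS+1≡ℕ→ℚ n m) ⟩
  (n ! ÷ k ! ℕ.* m !) * ℕ→ℚ N                   ≡⟨ ÷-*-÷ (n !) N (k ! ℕ.* m !) 1 ⟩
  n ! ℕ.* N ÷ k ! ℕ.* m ! ℕ.* 1                 ≡⟨ ÷-cong {n ! ℕ.* N} refl (ℕ.*-identityʳ (k ! ℕ.* m !)) ⟩
  n ! ℕ.* N ÷ k ! ℕ.* m !                       ∎
  where
  open ≡-Reasoning
  N = n ℕ.* Sℕ m ℕ.+ 1
  instance
    _ : NonZero (k ! ℕ.* m !)
    _ = k !* m !≢0
    _ : NonZero (k ! ℕ.* m ! ℕ.* 1)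
    _ = m*n≢0 (k ! ℕ.* m !) 1

p-above : ∀ {n k} → suc n < k → p n k ≡ 0ℚ
p-above {n} {k} 1+n<k with k ℕ.≤? suc n
... | yes k≤1+n = contradiction k≤1+n (ℕ.<⇒≱ 1+n<k)
... | no _      = refl

nCk*[k!*[n∸k]!]≡n! : ∀ {n k} → k ≤ n → (n C k) ℕ.* (k ! ℕ.* (n ∸ k) !) ≡ n !
nCk*[k!*[n∸k]!]≡n! {n} {k} k≤n = begin
  (n C k) ℕ.* (k ! ℕ.* (n ∸ k) !)                   ≡⟨ cong (ℕ._* (k ! ℕ.* (n ∸ k) !)) (nCk≡n!/k![n-k]! k≤n) ⟩
  n ! / (k ! ℕ.* (n ∸ k) !) ℕ.* (k ! ℕ.* (n ∸ k) !) ≡⟨ m/n*n≡m (k![n∸k]!∣n! k≤n) ⟩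
  n !                                             ∎
  where
  open ≡-Reasoning
  instance
    _ : NonZero (k ! ℕ.* (n ∸ k) !)
    _ = k !* (n ∸ k) !≢0

binomPred*k!*[d+1]!≡k*[k+d]! : ∀ k d → binomPred (k ℕ.+ d) k ℕ.* (k ! ℕ.* suc d !) ≡ k ℕ.* (k ℕ.+ d) !
binomPred*k!*[d+1]!≡k*[k+d]! zero    d = refl
binomPred*k!*[d+1]!≡k*[k+d]! (suc k) d = begin
  (n C k) ℕ.* (suc k ! ℕ.* suc d !)            ≡⟨ *-pull (n C k) (suc k) (k !) (suc d !) ⟩
  suc k ℕ.* ((n C k) ℕ.* (k ! ℕ.* suc d !))    ≡⟨ cong (λ j → suc k ℕ.* ((n C k) ℕ.* (k ! ℕ.* j !))) n∸k≡1+d ⟨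
  suc k ℕ.* ((n C k) ℕ.* (k ! ℕ.* (n ∸ k) !))  ≡⟨ cong (suc k ℕ.*_) (nCk*[k!*[n∸k]!]≡n! k≤n) ⟩
  suc k ℕ.* n !                                ∎
  where
  open ≡-Reasoning
  n = suc (k ℕ.+ d)
  k≤n : k ≤ n
  k≤n = ℕ.m≤n⇒m≤1+n (ℕ.m≤m+n k d)
  n∸k≡1+d : n ∸ k ≡ suc d
  n∸k≡1+d = trans (ℕ.+-∸-assoc 1 (ℕ.m≤m+n k d)) (cong suc (ℕ.m+n∸m≡n k d))
  *-pull : ∀ c j x y → c ℕ.* (j ℕ.* x ℕ.* y) ≡ j ℕ.* (c ℕ.* (x ℕ.* y))
  *-pull = solve-∀

p-recurrence′ : ∀ k d → let n = k ℕ.+ d in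
                p n k ≡ ℕ→ℚ (suc k) * p n (suc k) + ℕ→ℚ (binomPred n k)
p-recurrence′ k d = begin
  p n k                                 ≡⟨ p-closed n k (suc d) (ℕ.+-suc k d) ⟩
  X ÷ D₁                                ≡⟨ ÷-cross X (suc k ℕ.* Y ℕ.+ B ℕ.* D₂) D₁ D₂ cross ⟩
  (suc k ℕ.* Y ℕ.+ B ℕ.* D₂) ÷ D₂       ≡⟨ ÷-+-ℕ→ℚ (suc k ℕ.* Y) B D₂ ⟨
  suc k ℕ.* Y ÷ D₂ + ℕ→ℚ B              ≡⟨ cong (_+ ℕ→ℚ B) (ℕ→ℚ-*-÷ (suc k) Y D₂) ⟨
  ℕ→ℚ (suc k) * (Y ÷ D₂) + ℕ→ℚ B        ≡⟨ cong (λ x → ℕ→ℚ (suc k) * x + ℕ→ℚ B) (p-closed n (suc k) d refl) ⟨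
  ℕ→ℚ (suc k) * p n (suc k) + ℕ→ℚ B     ∎
  where
  open ≡-Reasoning
  n = k ℕ.+ d
  B = binomPred n k
  X = n ! ℕ.* (n ℕ.* Sℕ (suc d) ℕ.+ 1)
  Y = n ! ℕ.* (n ℕ.* Sℕ d ℕ.+ 1)
  D₁ = k ! ℕ.* suc d !
  D₂ = suc k ! ℕ.* d !
  instance
    _ : NonZero D₁
    _ = k !* suc d !≢0
    _ : NonZero D₂
    _ = suc k !* d !≢0
  identity : ∀ k d N K F s →
    N ℕ.* ((k ℕ.+ d) ℕ.* (suc d ℕ.* s ℕ.+ 1) ℕ.+ 1) ℕ.* (suc k ℕ.* K ℕ.* F)
    ≡ suc k ℕ.* (N ℕ.* ((k ℕ.+ d) ℕ.* s ℕ.+ 1)) ℕ.* (K ℕ.* (suc d ℕ.* F)) ℕ.+ k ℕ.* N ℕ.* (suc k ℕ.* K ℕ.* F)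
  identity = solve-∀
  split : ∀ c y b e f → (c ℕ.* y ℕ.+ b ℕ.* e) ℕ.* f ≡ c ℕ.* y ℕ.* f ℕ.+ b ℕ.* f ℕ.* e
  split = solve-∀
  cross : X ℕ.* D₂ ≡ (suc k ℕ.* Y ℕ.+ B ℕ.* D₂) ℕ.* D₁
  cross = begin
    X ℕ.* D₂                                 ≡⟨ identity k d (n !) (k !) (d !) (Sℕ d) ⟩
    suc k ℕ.* Y ℕ.* D₁ ℕ.+ k ℕ.* n ! ℕ.* D₂   ≡⟨ cong (λ x → suc k ℕ.* Y ℕ.* D₁ ℕ.+ x ℕ.* D₂)
                                                    (binomPred*k!*[d+1]!≡k*[k+d]! k d) ⟨
    suc k ℕ.* Y ℕ.* D₁ ℕ.+ B ℕ.* D₁ ℕ.* D₂    ≡⟨ split (suc k) Y B D₂ D₁ ⟨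
    (suc k ℕ.* Y ℕ.+ B ℕ.* D₂) ℕ.* D₁        ∎

p-recurrence : ∀ n k → k ≤ n → p n k ≡ ℕ→ℚ (suc k) * p n (suc k) + ℕ→ℚ (binomPred n k)
p-recurrence n k k≤n = subst (λ n → p n k ≡ ℕ→ℚ (suc k) * p n (suc k) + ℕ→ℚ (binomPred n k))
                             (ℕ.m+[n∸m]≡n k≤n) (p-recurrence′ k (n ∸ k))

p-top : ∀ n → p n (suc n) ≡ 1ℚ
p-top n = trans (p-closed n (suc n) 0 (ℕ.+-identityʳ (suc n)))
                (÷-cross (n ! ℕ.* (n ℕ.* 1 ℕ.+ 1)) 1 (suc n ! ℕ.* 1) 1 {{suc n !* 0 !≢0}} (identity n (n !)))
  where
  identity : ∀ n N → N ℕ.* (n ℕ.* 1 ℕ.+ 1) ℕ.* 1 ≡ 1 ℕ.* (suc n ℕ.* N ℕ.* 1)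
  identity = solve-∀

p-zero : ∀ n → p n 0 ≡ ℕ→ℚ n * S n + 1ℚ
p-zero n = begin
  p n 0                               ≡⟨ p-closed n 0 (suc n) refl ⟩
  X ÷ 1 ℕ.* suc n !                   ≡⟨ ÷-cross X (n ℕ.* Sℕ n ℕ.+ 1) (1 ℕ.* suc n !) 1 (identity n (n !) (Sℕ n)) ⟩
  ℕ→ℚ (n ℕ.* Sℕ n ℕ.+ 1)              ≡⟨ nS+1≡ℕ→ℚ n n ⟨
  ℕ→ℚ n * S n + 1ℚ                    ∎
  where
  open ≡-Reasoning
  X = n ! ℕ.* (n ℕ.* Sℕ (suc n) ℕ.+ 1)
  instance
    _ : NonZero (1 ℕ.* suc n !)
    _ = 0 !* suc n !≢0
  identity : ∀ n N s → N ℕ.* (n ℕ.* (suc n ℕ.* s ℕ.+ 1) ℕ.+ 1) ℕ.* 1 ≡ (n ℕ.* s ℕ.+ 1) ℕ.* (1 ℕ.* (suc n ℕ.* N))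
  identity = solve-∀

p-integral′ : ∀ n k d → k ℕ.+ d ≡ suc n → ∃[ m ] p n k ≡ ℕ→ℚ m
p-integral′ n k zero    k+0≡1+n =
  1 , subst (λ j → p n j ≡ 1ℚ) (trans (sym k+0≡1+n) (ℕ.+-identityʳ k)) (p-top n)
p-integral′ n k (suc d) k+1+d≡1+n with p-integral′ n (suc k) d (trans (sym (ℕ.+-suc k d)) k+1+d≡1+n)
... | m , p[1+k]≡m = suc k ℕ.* m ℕ.+ binomPred n k , (begin
  p n k                                           ≡⟨ p-recurrence n k k≤n ⟩
  ℕ→ℚ (suc k) * p n (suc k) + ℕ→ℚ (binomPred n k) ≡⟨ cong (λ x → ℕ→ℚ (suc k) * x + ℕ→ℚ (binomPred n k)) p[1+k]≡m ⟩
  ℕ→ℚ (suc k) * ℕ→ℚ m + ℕ→ℚ (binomPred n k)       ≡⟨ cong (_+ ℕ→ℚ (binomPred n k)) (ℕ→ℚ-homo-* (suc k) m) ⟨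
  ℕ→ℚ (suc k ℕ.* m) + ℕ→ℚ (binomPred n k)         ≡⟨ ℕ→ℚ-homo-+ (suc k ℕ.* m) (binomPred n k) ⟨
  ℕ→ℚ (suc k ℕ.* m ℕ.+ binomPred n k)             ∎)
  where
  open ≡-Reasoning
  k≤n : k ≤ n
  k≤n = ℕ.m+n≤o⇒m≤o k (ℕ.≤-reflexive (ℕ.suc-injective (trans (sym (ℕ.+-suc k d)) k+1+d≡1+n)))

p-integral : ∀ n k → ∃[ m ] p n k ≡ ℕ→ℚ m
p-integral n k with ℕ.≤-<-connex k (suc n)
... | inj₁ k≤1+n = p-integral′ n k (suc n ∸ k) (ℕ.m+[n∸m]≡n k≤1+n)
... | inj₂ 1+n<k = 0 , p-above 1+n<k

Q-suc : ∀ k n → Q (suc k) n ≡ Q k n ℤ.+ + (k ! ℕ.* binomPred n k)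
Q-suc zero    n = refl
Q-suc (suc k) n = begin
  -[1+ 0 ] ℤ.+ Σℤ[ 2 ⋯ suc (suc k) ] g            ≡⟨ cong (ℤ._+_ -[1+ 0 ]) (Σℤ-suc 2 (suc k) g (s≤s (s≤s z≤n))) ⟩
  -[1+ 0 ] ℤ.+ (Σℤ[ 2 ⋯ suc k ] g ℤ.+ g (2 ℕ.+ k)) ≡⟨ ℤ.+-assoc -[1+ 0 ] (Σℤ[ 2 ⋯ suc k ] g) (g (2 ℕ.+ k)) ⟨
  Q (suc k) n ℤ.+ g (2 ℕ.+ k)                     ∎
  where
  open ≡-Reasoning
  g : ℕ → ℤ
  g j = + ((j ∸ 1) ! ℕ.* (n C (j ∸ 2)))

k!*p+Q≡nS : ∀ n k → k ≤ suc n → ℕ→ℚ (k !) * p n k + ℤ→ℚ (Q k n) ≡ ℕ→ℚ n * S n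
k!*p+Q≡nS n zero    _ = begin
  1ℚ * p n 0 - 1ℚ                    ≡⟨ cong (λ x → 1ℚ * x - 1ℚ) (p-zero n) ⟩
  1ℚ * (ℕ→ℚ n * S n + 1ℚ) - 1ℚ       ≡⟨ cancel (ℕ→ℚ n * S n) ⟩
  ℕ→ℚ n * S n                        ∎
  where
  open ≡-Reasoning
  cancel : ∀ a → 1ℚ * (a + 1ℚ) - 1ℚ ≡ a
  cancel = solve 1 (λ a → con 1ℚ :* (a :+ con 1ℚ) :- con 1ℚ := a) refl
k!*p+Q≡nS n (suc k) (s≤s k≤n) = begin
  ℕ→ℚ (suc k !) * x + ℤ→ℚ (Q (suc k) n)            ≡⟨ cong₂ _+_ (cong (_* x) (ℕ→ℚ-homo-* (suc k) (k !))) Q-sucℚ ⟩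
  c * f * x + (q + f * b)                          ≡⟨ regroup c f x q b ⟩
  f * (c * x + b) + q                              ≡⟨ cong (λ y → f * y + q) (p-recurrence n k k≤n) ⟨
  f * p n k + q                                    ≡⟨ k!*p+Q≡nS n k (ℕ.m≤n⇒m≤1+n k≤n) ⟩
  ℕ→ℚ n * S n                                      ∎
  where
  open ≡-Reasoning
  c = ℕ→ℚ (suc k)
  f = ℕ→ℚ (k !)
  x = p n (suc k)
  q = ℤ→ℚ (Q k n)
  b = ℕ→ℚ (binomPred n k)
  Q-sucℚ : ℤ→ℚ (Q (suc k) n) ≡ q + f * b
  Q-sucℚ = begin
    ℤ→ℚ (Q (suc k) n)                          ≡⟨ cong ℤ→ℚ (Q-suc k n) ⟩
    ℤ→ℚ (Q k n ℤ.+ + (k ! ℕ.* binomPred n k))  ≡⟨ ℤ→ℚ-homo-+ (Q k n) _ ⟩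
    q + ℕ→ℚ (k ! ℕ.* binomPred n k)            ≡⟨ cong (_+_ q) (ℕ→ℚ-homo-* (k !) (binomPred n k)) ⟩
    q + f * b                                  ∎
  regroup : ∀ c f x q b → c * f * x + (q + f * b) ≡ f * (c * x + b) + q
  regroup = solve 5 (λ c f x q b → c :* f :* x :+ (q :+ f :* b) := f :* (c :* x :+ b) :+ q) refl

k!*inv!k≡1 : ∀ k → ℕ→ℚ (k !) * inv! k ≡ 1ℚ
k!*inv!k≡1 k = trans (ℕ→ℚ-*-÷ (k !) 1 (k !) {{k !≢0}})
                     (÷-cross (k ! ℕ.* 1) 1 (k !) 1 {{k !≢0}} (trans (ℕ.*-identityʳ (k ! ℕ.* 1)) (ℕ.*-comm (k !) 1)))

p-formula : ∀ n k → k ≤ suc n → p n k ≡ (ℕ→ℚ n * S n - ℤ→ℚ (Q k n)) * inv! k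
p-formula n k k≤1+n = begin
  x                            ≡⟨ ℚ.*-identityʳ x ⟨
  x * 1ℚ                       ≡⟨ cong (x *_) (k!*inv!k≡1 k) ⟨
  x * (f * i)                  ≡⟨ unscale x f i q ⟩
  (f * x + q - q) * i          ≡⟨ cong (λ y → (y - q) * i) (k!*p+Q≡nS n k k≤1+n) ⟩
  (ℕ→ℚ n * S n - q) * i        ∎
  where
  open ≡-Reasoning
  x = p n k
  f = ℕ→ℚ (k !)
  i = inv! k
  q = ℤ→ℚ (Q k n)
  unscale : ∀ x f i q → x * (f * i) ≡ (f * x + q - q) * i
  unscale = solve 4 (λ x f i q → x :* (f :* i) := (f :* x :+ q :- q) :* i) refl

k!*nCk≡nPk : ∀ n k → k ! ℕ.* (n C k) ≡ n P k
k!*nCk≡nPk n k with ℕ.≤-<-connex k n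
... | inj₂ n<k = trans (cong (k ! ℕ.*_) (k>n⇒nCk≡0 n<k)) (trans (ℕ.*-zeroʳ (k !)) (sym (k>n⇒nPk≡0 n<k)))
... | inj₁ k≤n = sym (begin
  n P k                                      ≡⟨ nPk≡n!/[n∸k]! k≤n ⟩
  n ! / (n ∸ k) !                            ≡⟨ /-congˡ (nCk*[k!*[n∸k]!]≡n! k≤n) ⟨
  (n C k) ℕ.* (k ! ℕ.* (n ∸ k) !) / (n ∸ k) ! ≡⟨ /-congˡ (swap (k !) (n C k) ((n ∸ k) !)) ⟩
  k ! ℕ.* (n C k) ℕ.* (n ∸ k) ! / (n ∸ k) !  ≡⟨ m*n/n≡m (k ! ℕ.* (n C k)) ((n ∸ k) !) ⟩
  k ! ℕ.* (n C k)                            ∎)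
  where
  open ≡-Reasoning
  instance
    _ : NonZero ((n ∸ k) !)
    _ = (n ∸ k) !≢0
  swap : ∀ a b c → b ℕ.* (a ℕ.* c) ≡ a ℕ.* b ℕ.* c
  swap = solve-∀

Q≡Q′ : ∀ k n → Q k n ≡ Q′ k n
Q≡Q′ k n = cong (ℤ._+_ -[1+ 0 ]) (Σℤ-cong 2 k
  (λ j → + ((j ∸ 1) ! ℕ.* (n C (j ∸ 2)))) (λ j → + ((j ∸ 1) ℕ.* (n P (j ∸ 2))))
  (λ i → cong +_ (trans (ℕ.*-assoc (suc i) (i !) (n C i)) (cong (suc i ℕ.*_) (k!*nCk≡nPk n i)))))

p-small-k : ∀ n → p n 0 ≡ ℕ→ℚ n * S n + 1ℚ × p n 1 ≡ ℕ→ℚ n * S n + 1ℚ × p n 2 ≡ ℕ→ℚ n * S n * ½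
p-small-k n = p-zero n , trans (p-formula n 1 (s≤s z≤n)) (ℚ.*-identityʳ _) , p-two n
  where
  p-two : ∀ n → p n 2 ≡ ℕ→ℚ n * S n * ½
  p-two zero    = refl
  p-two (suc n) = trans (p-formula (suc n) 2 (s≤s (s≤s z≤n))) (cong (_* ½) (ℚ.+-identityʳ (ℕ→ℚ (suc n) * S (suc n))))

proposition5p5 :
      ((∀ n k → ∃[ m ] p n k ≡ ℕ→ℚ m)
       × (∀ n k → k ≤ n → p n k ≡ ℕ→ℚ (suc k) * p n (suc k) + ℕ→ℚ (binomPred n k))
       × (∀ n → p n (suc n) ≡ 1ℚ))
    × ((∀ n k → k ≤ suc n → p n k ≡ (ℕ→ℚ n * S n - ℤ→ℚ (Q k n)) * inv! k)
       × (∀ k n → Q k n ≡ Q′ k n)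
       × (∀ n → Q 0 n ≡ -[1+ 0 ] × Q 1 n ≡ -[1+ 0 ] × Q 2 n ≡ + 0)
       × (∀ n → p n 0 ≡ ℕ→ℚ n * S n + 1ℚ × p n 1 ≡ ℕ→ℚ n * S n + 1ℚ × p n 2 ≡ ℕ→ℚ n * S n * ½))
proposition5p5 =
  (p-integral , p-recurrence , p-top) ,
  (p-formula , Q≡Q′ , (λ n → refl , refl , refl) , p-small-k)
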